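{- Let $\mathbb{F}_q$ be a finite field of constant prime order $q$, and let $C(\bar x)$ be an algebraic circuit of depth $\Delta$ over $\mathbb{F}_q$ in the variables $\bar x$. Then $$\{x^q-x=0 : x\text{ a variable of }C\},\ \mathrm{SCNF}(C(\bar x)=0)\ \vdash^{*,O(\Delta)}_{\mathrm{IPS}^{\mathrm{alg}}}\ C(\bar x)=0.$$
   Context: $\mathcal{A}\vdash^{*,O(\Delta)}_{\mathrm{IPS}^{\mathrm{alg}}}\mathcal{B}$ means every equation $p=0$ in $\mathcal{B}$ has an $\mathrm{IPS}^{\mathrm{alg}}$ proof from $\mathcal{A}=\{f_j=0\}_{j\in[m]}$ of size polynomial in $|C|$ and depth $O(\Delta)$; an $\mathrm{IPS}^{\mathrm{alg}}$ proof is an algebraic circuit $D(\bar v,t_1,\dots,t_m)$ with $\hat D(\bar v,\bar0)=0$ and $\hat D(\bar v,f_1,\dots,f_m)=p$ (no Boolean axioms added). $\mathrm{UBIT}_j(h)=\prod_{i\ne j}(h-i)/\prod_{i\ne j}(j-i)$, $i,j\in\{0,\dots,q-1\}$. Plain CNF encoding $\mathrm{cnf}(C(\bar x)=0)$: each gate and auxiliary node $g$ has unary bits $x_{g0},\dots,x_{g(q-1)}$. For each input $x_i$: clause $\bigvee_jx_{x_ij}$ and clauses $\neg x_{x_ij}\vee\neg x_{x_il}$ ($j\ne l$). Scalar inputs contribute constant unary bits. A gate $g$ of type $\circ\in\{+,\times\}$ with inputs $u_1,\dots,u_t$ is decomposed into $u_1\circ u_2=v^g_1$, $u_{i+2}\circ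 v^g_i=v^g_{i+1}$ ($1\le i\le t-3$), $u_t\circ v^g_{t-2}=g$; each binary equation $a\circ b=c$ gets a CNF in the unary bits of $a,b,c$ satisfied exactly when the bits of $c$ are correct per the truth table of $\circ$ over $\mathbb{F}_q$ (unsatisfiable if more than one bit of $a$, $b$ or $c$ is $1$). Also $x_{gi}^2-x_{gi}=0$ for all unary bits, and $x_{g_{out}0}=1$, $x_{g_{out}i}=0$ ($i\ge1$) for the output gate. Clauses $\bigvee_{i\in P}v_i\vee\bigvee_{j\in N}\neg v_j$ are written as $\prod_{i\in P}(1-v_i)\prod_{j\in N}v_j=0$. $\mathrm{SCNF}(C(\bar x)=0)$ is obtained from $\mathrm{cnf}(C(\bar x)=0)$ by substituting each unary bit $x_{uj}$ by $\mathrm{UBIT}_j(C_u)$, where $C_u$ is the constant-depth algebraic circuit (built from $C$) computing node $u$. -}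

module Defs where

open import Data.Nat using (ℕ; zero; suc; _+_; _*_; _∸_; _^_; _⊔_; NonZero; _≡ᵇ_)
open import Data.Nat.DivMod using (_%_; m%n<n)
open import Data.Fin using (Fin; toℕ; fromℕ<) renaming (zero to fz; suc to fs)
open import Data.List using (List; []; _∷_; _++_; map; concatMap; length; foldr; lookup; allFin)
open import Data.Bool using (Bool; true; false; _∧_; _∨_; not; if_then_else_)
open import Data.Product using (_×_; _,_; proj₁; proj₂)
open import Data.Sum using (_⊎_; inj₁; inj₂)

-- Formal polynomials over F_q  (F_q[V] = free commutative ring on V
-- with the relation  q = 0; constants are natural-number literals)

infixl 6 _⊕_
infixl 7 _⊗_

data Expr (V : Set) : Set where
  var  : V → Expr V
  cst  : ℕ → Expr V
  _⊕_  : Expr V → Expr V → Expr V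
  _⊗_  : Expr V → Expr V → Expr V
  ⊖_   : Expr V → Expr V

data PolyEq {V : Set} (q : ℕ) : Expr V → Expr V → Set where
  ≈refl   : ∀ {a} → PolyEq q a a
  ≈sym    : ∀ {a b} → PolyEq q a b → PolyEq q b a
  ≈trans  : ∀ {a b c} → PolyEq q a b → PolyEq q b c → PolyEq q a c
  ⊕-cong  : ∀ {a b c d} → PolyEq q a b → PolyEq q c d → PolyEq q (a ⊕ c) (b ⊕ d)
  ⊗-cong  : ∀ {a b c d} → PolyEq q a b → PolyEq q c d → PolyEq q (a ⊗ c) (b ⊗ d)
  ⊖-cong  : ∀ {a b} → PolyEq q a b → PolyEq q (⊖ a) (⊖ b)
  ⊕-assoc : ∀ a b c → PolyEq q ((a ⊕ b) ⊕ c) (a ⊕ (b ⊕ c))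
  ⊕-comm  : ∀ a b → PolyEq q (a ⊕ b) (b ⊕ a)
  ⊕-idˡ   : ∀ a → PolyEq q (cst 0 ⊕ a) a
  ⊕-invʳ  : ∀ a → PolyEq q (a ⊕ ⊖ a) (cst 0)
  ⊗-assoc : ∀ a b c → PolyEq q ((a ⊗ b) ⊗ c) (a ⊗ (b ⊗ c))
  ⊗-comm  : ∀ a b → PolyEq q (a ⊗ b) (b ⊗ a)
  ⊗-idˡ   : ∀ a → PolyEq q (cst 1 ⊗ a) a
  distribˡ : ∀ a b c → PolyEq q (a ⊗ (b ⊕ c)) ((a ⊗ b) ⊕ (a ⊗ c))
  cst-⊕   : ∀ m n → PolyEq q (cst m ⊕ cst n) (cst (m + n))
  cst-⊗   : ∀ m n → PolyEq q (cst m ⊗ cst n) (cst (m * n))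
  cst-char : PolyEq q (cst q) (cst 0)

_^ᵉ_ : ∀ {V} → Expr V → ℕ → Expr V
e ^ᵉ zero = cst 1
e ^ᵉ suc k = e ⊗ (e ^ᵉ k)

substE : ∀ {V W} → (V → Expr W) → Expr V → Expr W
substE σ (var v) = σ v
substE σ (cst c) = cst c
substE σ (a ⊕ b) = substE σ a ⊕ substE σ b
substE σ (a ⊗ b) = substE σ a ⊗ substE σ b
substE σ (⊖ a) = ⊖ substE σ a

prodFin : ∀ {V} n → (Fin n → Expr V) → Expr V
prodFin zero f = cst 1
prodFin (suc n) f = f fz ⊗ prodFin n (λ i → f (fs i))

prodℕ : ∀ n → (Fin n → ℕ) → ℕ
prodℕ zero f = 1
prodℕ (suc n) f = f fz * prodℕ n (λ i → f (fs i))

allB : ∀ n → (Fin n → Bool) → Bool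
allB zero f = true
allB (suc n) f = f fz ∧ allB n (λ i → f (fs i))

anyB : ∀ n → (Fin n → Bool) → Bool
anyB zero f = false
anyB (suc n) f = f fz ∨ anyB n (λ i → f (fs i))

eqF : ∀ {n} → Fin n → Fin n → Bool
eqF i j = toℕ i ≡ᵇ toℕ j

-- A circuit is a list of nodes, newest first; a node may only
-- refer to older nodes (Fin k indexes the tail, 0 = immediately older).
-- The output gate is the head.

data Op : Set where
  plus times : Op

data Gate (q : ℕ) (V : Set) (k : ℕ) : Set where
  input  : V → Gate q V k
  scalar : Fin q → Gate q V k
  gate   : Op → Fin k → Fin k → List (Fin k) → Gate q V k

data Circuit (q : ℕ) (V : Set) : ℕ → Set where
  []  : Circuit q V 0
  _◁_ : ∀ {k} → Gate q V k → Circuit q V k → Circuit q V (suc k)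

opE : ∀ {V} → Op → Expr V → Expr V → Expr V
opE plus a b = a ⊕ b
opE times a b = a ⊗ b

-- v₁ = u₁ ∘ u₂ ;  v_{i+1} = u_{i+2} ∘ v_i ; last one is the gate itself
chainFrom : ∀ {V} → Op → Expr V → List (Expr V) → Expr V
chainFrom o acc [] = acc
chainFrom o acc (u ∷ us) = chainFrom o (opE o u acc) us

chainEqs : ∀ {V} → Op → Expr V → List (Expr V) → List (Expr V × Expr V × Expr V)
chainEqs o acc [] = []
chainEqs o acc (u ∷ us) = (u , acc , opE o u acc) ∷ chainEqs o (opE o u acc) us

gateEqs : ∀ {V} → Op → Expr V → Expr V → List (Expr V) → List (Expr V × Expr V × Expr V)
gateEqs o a b us = (a , b , opE o a b) ∷ chainEqs o (opE o a b) us

gatePoly : ∀ {q V k} → (Fin k → Expr V) → Gate q V k → Expr V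
gatePoly P (input v) = var v
gatePoly P (scalar c) = cst (toℕ c)
gatePoly P (gate o i j us) = chainFrom o (opE o (P i) (P j)) (map P us)

nodePoly : ∀ {q V k} → Circuit q V k → Fin k → Expr V
nodePoly (g ◁ C) fz = gatePoly (nodePoly C) g
nodePoly (g ◁ C) (fs i) = nodePoly C i

outPoly : ∀ {q V k} → Circuit q V (suc k) → Expr V
outPoly C = nodePoly C fz

maxList : List ℕ → ℕ
maxList = foldr _⊔_ 0

nodeDepth : ∀ {q V k} → Circuit q V k → Fin k → ℕ
nodeDepth (input v ◁ C) fz = 0
nodeDepth (scalar c ◁ C) fz = 0
nodeDepth (gate o i j us ◁ C) fz =
  suc (nodeDepth C i ⊔ nodeDepth C j ⊔ maxList (map (nodeDepth C) us))
nodeDepth (g ◁ C) (fs i) = nodeDepth C i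

depth : ∀ {q V k} → Circuit q V k → ℕ
depth [] = 0
depth (g ◁ C) = nodeDepth (g ◁ C) fz ⊔ depth C

-- size = number of nodes + number of wires
gateSize : ∀ {q V k} → Gate q V k → ℕ
gateSize (input v) = 1
gateSize (scalar c) = 1
gateSize (gate o i j us) = 3 + length us

size : ∀ {q V k} → Circuit q V k → ℕ
size [] = 0
size (g ◁ C) = gateSize g + size C

-- UBIT_j(h) = ∏_{i≠j} (h - i) / ∏_{i≠j} (j - i)   over F_q.
-- The inverse of the (nonzero mod q) denominator d is d^(q-2) (Fermat).

ubitDen : (q : ℕ) → Fin q → ℕ
ubitDen q j = prodℕ q (λ i → if eqF i j then 1 else (toℕ j + q ∸ toℕ i))

UBIT : ∀ {V} (q : ℕ) → Fin q → Expr V → Expr V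
UBIT q j h = cst (ubitDen q j ^ (q ∸ 2))
           ⊗ prodFin q (λ i → if eqF i j then cst 1 else (h ⊕ ⊖ cst (toℕ i)))

-- the unary bit x_{uj}, already substituted by UBIT_j(C_u)
bit : ∀ {V} (q : ℕ) → Expr V → Fin q → Expr V
bit q h j = UBIT q j h

-- literal polynomials: positive literal v ↦ (1 - v), negative literal ¬v ↦ v
lit : ∀ {V} → Bool → Expr V → Expr V
lit true v = v                 -- assignment has v = 1, clause contains ¬v
lit false v = cst 1 ⊕ ⊖ v      -- assignment has v = 0, clause contains v

opF : (q : ℕ) .{{_ : NonZero q}} → Op → Fin q → Fin q → Fin q
opF q plus i j = fromℕ< (m%n<n (toℕ i + toℕ j) q)
opF q times i j = fromℕ< (m%n<n (toℕ i * toℕ j) q)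

oneHotAt : ∀ {q} → (Fin q → Bool) → Fin q → Bool
oneHotAt {q} α i = allB q (λ i' → if eqF i' i then α i' else not (α i'))

-- truth table of the binary equation a ∘ b = c on the 3q unary bits
correct : (q : ℕ) .{{_ : NonZero q}} → Op →
          (Fin q → Bool) → (Fin q → Bool) → (Fin q → Bool) → Bool
correct q o α β γ =
  anyB q (λ i → anyB q (λ j → oneHotAt α i ∧ oneHotAt β j ∧ oneHotAt γ (opF q o i j)))

cons : ∀ {n} → Bool → (Fin n → Bool) → Fin (suc n) → Bool
cons b f fz = b
cons b f (fs i) = f i

allAssign : ∀ n → List (Fin n → Bool)
allAssign zero = (λ ()) ∷ []
allAssign (suc n) = concatMap (λ f → cons true f ∷ cons false f ∷ []) (allAssign n)

-- canonical (truth-table) CNF of a ∘ b = c : one clause excluding each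
-- falsifying assignment of the unary bits of a, b, c
binCNF : ∀ {V} (q : ℕ) .{{_ : NonZero q}} → Op → Expr V × Expr V × Expr V → List (Expr V)
binCNF q o (a , b , c) =
  concatMap (λ α → concatMap (λ β → concatMap (λ γ →
      if correct q o α β γ then []
      else (prodFin q (λ i → lit (α i) (bit q a i))
            ⊗ prodFin q (λ i → lit (β i) (bit q b i))
            ⊗ prodFin q (λ i → lit (γ i) (bit q c i))) ∷ [])
    (allAssign q)) (allAssign q)) (allAssign q)

boolAx : ∀ {V} (q : ℕ) → Expr V → List (Expr V)
boolAx q h = map (λ i → (bit q h i ^ᵉ 2) ⊕ ⊖ bit q h i) (allFin q)

-- clauses  ⋁_j x_{x_i j}  and  ¬x_{x_i j} ∨ ¬x_{x_i l}  (j ≠ l)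
inputClauses : ∀ {V} (q : ℕ) → Expr V → List (Expr V)
inputClauses q h =
  prodFin q (λ j → lit false (bit q h j))
  ∷ concatMap (λ j → concatMap (λ l →
        if eqF j l then [] else (bit q h j ⊗ bit q h l) ∷ []) (allFin q)) (allFin q)

nodeClauses : ∀ {V k} (q : ℕ) .{{_ : NonZero q}} → (Fin k → Expr V) → Gate q V k → List (Expr V)
nodeClauses q P (input v) = inputClauses q (var v) ++ boolAx q (var v)
nodeClauses q P (scalar c) = boolAx q (cst (toℕ c))
nodeClauses q P (gate o i j us) =
  boolAx q (gatePoly {q} P (gate o i j us))
  ++ concatMap (λ t → binCNF q o t ++ boolAx q (proj₂ (proj₂ t)))
               (gateEqs o (P i) (P j) (map P us))

scnfNodes : ∀ {V k} (q : ℕ) .{{_ : NonZero q}} → Circuit q V k → List (Expr V)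
scnfNodes q [] = []
scnfNodes {V} {suc k} q (g ◁ C) = nodeClauses {V} {k} q (nodePoly C) g ++ scnfNodes q C

outputAx : ∀ {V} (q : ℕ) → Expr V → List (Expr V)
outputAx q h = map (λ i → if toℕ i ≡ᵇ 0 then bit q h i ⊕ ⊖ cst 1 else bit q h i) (allFin q)

SCNF : ∀ {V k} (q : ℕ) .{{_ : NonZero q}} → Circuit q V (suc k) → List (Expr V)
SCNF q C = scnfNodes q C ++ outputAx q (outPoly C)

fieldAx : ∀ {V k} (q : ℕ) → Circuit q V k → List (Expr V)
fieldAx q [] = []
fieldAx q (input v ◁ C) = ((var v ^ᵉ q) ⊕ ⊖ var v) ∷ fieldAx q C
fieldAx q (scalar c ◁ C) = fieldAx q C
fieldAx q (gate o i j us ◁ C) = fieldAx q C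

record IPSProof (q n : ℕ) (A : List (Expr (Fin n))) (p : Expr (Fin n)) : Set where
  field
    k : ℕ
    D : Circuit q (Fin n ⊎ Fin (length A)) (suc k)
    vanish : PolyEq q (substE (λ { (inj₁ v) → var v ; (inj₂ j) → cst 0 }) (outPoly D)) (cst 0)
    derive : PolyEq q (substE (λ { (inj₁ v) → var v ; (inj₂ j) → lookup A j }) (outPoly D)) p

-- Over F_q the polynomial X equals Σ_j j · c_j · UBIT_j(X) in F_q[X], where c_j inverts UBIT_j(j)
-- modulo q (a Bézout inverse, which avoids Fermat's little theorem): the difference has degree < q
-- and vanishes at every point of F_q, and synthetic division shows that such a polynomial is zero.
-- Substituting the output polynomial C for X, the summand j = 0 drops out and the remaining ones are
-- multiples of the output axioms UBIT_j(C) = 0 (j ≠ 0) of SCNF. So C is an F_q-linear combination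
-- of axioms, an IPS^alg proof whose size and depth depend on q only.

module Submission where

open import Defs
open import Level using (0ℓ)
open import Function using (_∘_)
open import Data.Unit using (⊤; tt)
open import Data.Bool using (true; false; if_then_else_)
open import Data.Bool.Properties using (if-float)
open import Data.Maybe using (nothing)
open import Data.Product using (Σ; _×_; _,_; proj₁; proj₂)
open import Data.Sum using (_⊎_; inj₁; inj₂)
open import Data.Nat using (ℕ; zero; suc; _+_; _*_; _∸_; _^_; _≤_; _<_; _⊔_; z≤n; s≤s; NonZero; >-nonZero; nonTrivial⇒n>1; nonTrivial⇒≢1)
import Data.Nat.Properties as ℕ
open import Data.Nat.Properties using (≡ᵇ⇒≡; ≡⇒≡ᵇ)
open import Data.Nat.Divisibility using (_∣_; divides; m∣m*n; ∣1⇒≡1; ∣m∣n⇒∣m+n; ∣m+n∣m⇒∣n; ∣m⇒∣m*n; ∣n⇒∣m*n)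
open import Data.Nat.DivMod using (_%_; _/_; _mod_; m%n<n; m≡m%n+[m/n]*n; %-remove-+ˡ; [m+kn]%n≡m%n; m<n⇒m%n≡m)
open import Data.Nat.Primality using (Prime; ¬prime[0]; prime⇒nonTrivial; prime⇒irreducible; euclidsLemma)
open import Data.Nat.Coprimality using (Coprime; coprime-Bézout; coprime-divisor; prime⇒coprime)
open import Data.Nat.GCD using (module Bézout)
open import Data.Nat.Tactic.RingSolver using (solve-∀)
open import Data.Fin using (Fin; toℕ; fromℕ<) renaming (zero to fz; suc to fs)
open import Data.Fin.Properties using (toℕ<n; toℕ-fromℕ<; toℕ-injective; suc-injective)
open import Data.List using (List; []; _∷_; length; _++_; map)
open import Data.List.Properties using (length-map)
open import Data.List.Relation.Unary.All using (All; []; _∷_)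
open import Data.List.Relation.Unary.Any using (index)
open import Data.List.Relation.Unary.Any.Properties using (lookup-index)
open import Data.List.Membership.Propositional using (_∈_)
open import Data.List.Membership.Propositional.Properties using (∈-map⁺; ∈-++⁺ʳ; ∈-allFin)
open import Relation.Nullary using (¬_; contradiction)
open import Relation.Nullary.Reflects using (Reflects; ofʸ; ofⁿ; fromEquivalence)
open import Relation.Binary.PropositionalEquality
  using (_≡_; _≢_; refl; sym; trans; cong; cong₂; subst; ≢-sym; module ≡-Reasoning)
open import Algebra.Bundles using (CommutativeRing)
import Algebra.Properties.Ring as RingProperties
import Relation.Binary.Reasoning.Setoid as SetoidReasoning
open import Tactic.RingSolver.Core.AlmostCommutativeRing using (fromCommutativeRing)
import Tactic.RingSolver.NonReflective as RingSolver

polynomialRing : ℕ → Set → CommutativeRing 0ℓ 0ℓ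
polynomialRing q V = record
  { Carrier = Expr V ; _≈_ = PolyEq q
  ; _+_ = _⊕_ ; _*_ = _⊗_ ; -_ = ⊖_ ; 0# = cst 0 ; 1# = cst 1
  ; isCommutativeRing = record
    { isRing = record
      { +-isAbelianGroup = record
        { isGroup = record
          { isMonoid = record
            { isSemigroup = record
              { isMagma = record
                { isEquivalence = record { refl = ≈refl ; sym = ≈sym ; trans = ≈trans }
                ; ∙-cong = ⊕-cong }
              ; assoc = ⊕-assoc }
            ; identity = ⊕-idˡ , λ a → ≈trans (⊕-comm a (cst 0)) (⊕-idˡ a) }
          ; inverse = (λ a → ≈trans (⊕-comm (⊖ a) a) (⊕-invʳ a)) , ⊕-invʳ
          ; ⁻¹-cong = ⊖-cong }
        ; comm = ⊕-comm }
      ; *-cong = ⊗-cong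
      ; *-assoc = ⊗-assoc
      ; *-identity = ⊗-idˡ , λ a → ≈trans (⊗-comm a (cst 1)) (⊗-idˡ a)
      ; distrib = distribˡ , λ a b c → ≈trans (⊗-comm (b ⊕ c) a)
                   (≈trans (distribˡ a b c) (⊕-cong (⊗-comm a b) (⊗-comm a c))) }
    ; *-comm = ⊗-comm } }

module PolynomialRing (q : ℕ) (V : Set) where
  open CommutativeRing (polynomialRing q V) public
    using (_≈_; setoid; reflexive; ring; zeroˡ; zeroʳ; +-identityʳ; *-identityʳ; distribʳ)
  open RingProperties ring public using (x∙y⁻¹≈ε⇒x≈y; +-inverseʳ-unique)
  open SetoidReasoning setoid public
  open RingSolver (fromCommutativeRing (polynomialRing q V) (λ _ → nothing)) public
    using (solve; _⊜_) renaming (_⊕_ to _:+_; _⊗_ to _:*_)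

substE-cong : ∀ {q V W} (σ : V → Expr W) {a b : Expr V} →
              PolyEq q a b → PolyEq q (substE σ a) (substE σ b)
substE-cong σ ≈refl = ≈refl
substE-cong σ (≈sym a≈b) = ≈sym (substE-cong σ a≈b)
substE-cong σ (≈trans a≈b b≈c) = ≈trans (substE-cong σ a≈b) (substE-cong σ b≈c)
substE-cong σ (⊕-cong a≈b c≈d) = ⊕-cong (substE-cong σ a≈b) (substE-cong σ c≈d)
substE-cong σ (⊗-cong a≈b c≈d) = ⊗-cong (substE-cong σ a≈b) (substE-cong σ c≈d)
substE-cong σ (⊖-cong a≈b) = ⊖-cong (substE-cong σ a≈b)
substE-cong σ (⊕-assoc a b c) = ⊕-assoc _ _ _
substE-cong σ (⊕-comm a b) = ⊕-comm _ _
substE-cong σ (⊕-idˡ a) = ⊕-idˡ _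
substE-cong σ (⊕-invʳ a) = ⊕-invʳ _
substE-cong σ (⊗-assoc a b c) = ⊗-assoc _ _ _
substE-cong σ (⊗-comm a b) = ⊗-comm _ _
substE-cong σ (⊗-idˡ a) = ⊗-idˡ _
substE-cong σ (distribˡ a b c) = distribˡ _ _ _
substE-cong σ (cst-⊕ m n) = cst-⊕ m n
substE-cong σ (cst-⊗ m n) = cst-⊗ m n
substE-cong σ cst-char = cst-char

sumFin : ∀ {V} n → (Fin n → Expr V) → Expr V
sumFin zero f = cst 0
sumFin (suc n) f = f fz ⊕ sumFin n (λ i → f (fs i))

substE-sumFin : ∀ {V W} (σ : V → Expr W) n (f : Fin n → Expr V) →
                substE σ (sumFin n f) ≡ sumFin n (λ i → substE σ (f i))
substE-sumFin σ zero f = refl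
substE-sumFin σ (suc n) f = cong (substE σ (f fz) ⊕_) (substE-sumFin σ n (λ i → f (fs i)))

substE-prodFin : ∀ {V W} (σ : V → Expr W) n (f : Fin n → Expr V) →
                 substE σ (prodFin n f) ≡ prodFin n (λ i → substE σ (f i))
substE-prodFin σ zero f = refl
substE-prodFin σ (suc n) f = cong (substE σ (f fz) ⊗_) (substE-prodFin σ n (λ i → f (fs i)))

prodFin-cong : ∀ {V} n {f g : Fin n → Expr V} → (∀ i → f i ≡ g i) → prodFin n f ≡ prodFin n g
prodFin-cong zero f≡g = refl
prodFin-cong (suc n) f≡g = cong₂ _⊗_ (f≡g fz) (prodFin-cong n (λ i → f≡g (fs i)))

ubitFactor : ∀ {V} q → Fin q → Expr V → Fin q → Expr V
ubitFactor q j h i = if eqF i j then cst 1 else (h ⊕ ⊖ cst (toℕ i))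

substE-UBIT : ∀ {V W} (σ : V → Expr W) q j (h : Expr V) →
              substE σ (UBIT q j h) ≡ UBIT q j (substE σ h)
substE-UBIT σ q j h = cong (cst (ubitDen q j ^ (q ∸ 2)) ⊗_)
  (trans (substE-prodFin σ q (ubitFactor q j h)) (prodFin-cong q (λ i → if-float (substE σ) (eqF i j))))

module _ {q : ℕ} {V : Set} where
  open PolynomialRing q V

  sumFin-cong : ∀ n {f g : Fin n → Expr V} → (∀ i → f i ≈ g i) → sumFin n f ≈ sumFin n g
  sumFin-cong zero f≈g = ≈refl
  sumFin-cong (suc n) f≈g = ⊕-cong (f≈g fz) (sumFin-cong n (λ i → f≈g (fs i)))

  sumFin-zero : ∀ n {f : Fin n → Expr V} → (∀ i → f i ≈ cst 0) → sumFin n f ≈ cst 0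
  sumFin-zero zero f≈0 = ≈refl
  sumFin-zero (suc n) f≈0 = ≈trans (⊕-cong (f≈0 fz) (sumFin-zero n (λ i → f≈0 (fs i)))) (⊕-idˡ _)

  cst-∣⇒≈0 : ∀ {c} → q ∣ c → cst c ≈ cst 0
  cst-∣⇒≈0 (divides k refl) = begin
    cst (k * q)    ≈⟨ cst-⊗ k q ⟨
    cst k ⊗ cst q  ≈⟨ ⊗-cong ≈refl cst-char ⟩
    cst k ⊗ cst 0  ≈⟨ zeroʳ (cst k) ⟩
    cst 0          ∎

  cst-mod : .{{_ : NonZero q}} → ∀ c → cst (toℕ (c mod q)) ≈ cst c
  cst-mod c = begin
    cst (toℕ (c mod q))            ≡⟨ cong cst (toℕ-fromℕ< (m%n<n c q)) ⟩
    cst (c % q)                    ≈⟨ +-identityʳ _ ⟨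
    cst (c % q) ⊕ cst 0            ≈⟨ ⊕-cong ≈refl (cst-∣⇒≈0 (divides (c / q) refl)) ⟨
    cst (c % q) ⊕ cst (c / q * q)  ≈⟨ cst-⊕ _ _ ⟩
    cst (c % q + c / q * q)        ≡⟨ cong cst (m≡m%n+[m/n]*n c q) ⟨
    cst c                          ∎

⊖≈p⊗ : ∀ {p V} (y : Expr V) → PolyEq (suc p) (⊖ y) (cst p ⊗ y)
⊖≈p⊗ {p} {V} y = ≈sym (+-inverseʳ-unique y (cst p ⊗ y) (begin
    y ⊕ cst p ⊗ y              ≈⟨ ⊕-cong (⊗-idˡ y) ≈refl ⟨
    cst 1 ⊗ y ⊕ cst p ⊗ y      ≈⟨ distribʳ y (cst 1) (cst p) ⟨
    (cst 1 ⊕ cst p) ⊗ y        ≈⟨ ⊗-cong (≈trans (cst-⊕ 1 p) cst-char) ≈refl ⟩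
    cst 0 ⊗ y                  ≈⟨ zeroˡ y ⟩
    cst 0                      ∎))
  where open PolynomialRing (suc p) V

-- Arithmetic modulo a prime

eqF-reflects-≡ : ∀ {n} (i j : Fin n) → Reflects (i ≡ j) (eqF i j)
eqF-reflects-≡ i j =
  fromEquivalence (toℕ-injective ∘ ≡ᵇ⇒≡ (toℕ i) (toℕ j)) (≡⇒≡ᵇ (toℕ i) (toℕ j) ∘ cong toℕ)

prodℕ-cong : ∀ n {f g : Fin n → ℕ} → (∀ i → f i ≡ g i) → prodℕ n f ≡ prodℕ n g
prodℕ-cong zero f≡g = refl
prodℕ-cong (suc n) f≡g = cong₂ _*_ (f≡g fz) (prodℕ-cong n (λ i → f≡g (fs i)))

∣-prodℕ : ∀ {q} n (f : Fin n → ℕ) i → q ∣ f i → q ∣ prodℕ n f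
∣-prodℕ (suc n) f fz q∣f[i] = ∣m⇒∣m*n _ q∣f[i]
∣-prodℕ (suc n) f (fs i) q∣f[i] = ∣n⇒∣m*n (f fz) (∣-prodℕ n (λ k → f (fs k)) i q∣f[i])

∣-offset⇒≡ : ∀ {q} .{{_ : NonZero q}} {i j : Fin q} {a} k →
             a + toℕ i ≡ toℕ j + k * q → q ∣ a → i ≡ j
∣-offset⇒≡ {q} {i} {j} {a} k a+i≡j+kq q∣a = toℕ-injective (begin
  toℕ i                ≡⟨ m<n⇒m%n≡m (toℕ<n i) ⟨
  toℕ i % q            ≡⟨ %-remove-+ˡ (toℕ i) q∣a ⟨
  (a + toℕ i) % q      ≡⟨ cong (_% q) a+i≡j+kq ⟩
  (toℕ j + k * q) % q  ≡⟨ [m+kn]%n≡m%n (toℕ j) k q ⟩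
  toℕ j % q            ≡⟨ m<n⇒m%n≡m (toℕ<n j) ⟩
  toℕ j                ∎)
  where open ≡-Reasoning

module _ {q : ℕ} (isPrime : Prime q) where

  ∤1 : ¬ q ∣ 1
  ∤1 q∣1 = nonTrivial⇒≢1 {{prime⇒nonTrivial isPrime}} (∣1⇒≡1 q∣1)

  ∤-* : ∀ {x y} → ¬ q ∣ x → ¬ q ∣ y → ¬ q ∣ x * y
  ∤-* {x} {y} q∤x q∤y q∣xy with euclidsLemma x y isPrime q∣xy
  ... | inj₁ q∣x = q∤x q∣x
  ... | inj₂ q∣y = q∤y q∣y

  ∤-^ : ∀ {x} k → ¬ q ∣ x → ¬ q ∣ x ^ k
  ∤-^ zero q∤x = ∤1
  ∤-^ (suc k) q∤x = ∤-* q∤x (∤-^ k q∤x)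

  ∤-prodℕ : ∀ n (f : Fin n → ℕ) → (∀ i → ¬ q ∣ f i) → ¬ q ∣ prodℕ n f
  ∤-prodℕ zero f q∤f = ∤1
  ∤-prodℕ (suc n) f q∤f = ∤-* (q∤f fz) (∤-prodℕ n (λ i → f (fs i)) (λ i → q∤f (fs i)))

  ∤⇒coprime : ∀ {y} → ¬ q ∣ y → Coprime y q
  ∤⇒coprime q∤y (d∣y , d∣q) with prime⇒irreducible isPrime d∣q
  ... | inj₁ d≡1 = d≡1
  ... | inj₂ refl = contradiction d∣y q∤y

-- Since p ≡ -1 (mod 1 + p), z is an inverse of y modulo 1 + p.
inverse-mod : ∀ {p} → Prime (suc p) → ∀ {y} → ¬ suc p ∣ y → Σ ℕ λ z → suc p ∣ y * z + p
inverse-mod {p} isPrime {y} q∤y with coprime-Bézout (∤⇒coprime isPrime q∤y)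
... | Bézout.+- x w 1+wq≡xy = x , divides (w + 1) (begin
  y * x + p          ≡⟨ cong (_+ p) (ℕ.*-comm y x) ⟩
  x * y + p          ≡⟨ cong (_+ p) 1+wq≡xy ⟨
  1 + w * suc p + p  ≡⟨ expand w p ⟩
  (w + 1) * suc p    ∎)
  where
  open ≡-Reasoning
  expand : ∀ w p → 1 + w * suc p + p ≡ (w + 1) * suc p
  expand = solve-∀
... | Bézout.-+ x w 1+xy≡wq = p * x , divides (p * w) (begin
  y * (p * x) + p    ≡⟨ factor y x p ⟩
  p * (1 + x * y)    ≡⟨ cong (p *_) 1+xy≡wq ⟩
  p * (w * suc p)    ≡⟨ ℕ.*-assoc p w (suc p) ⟨
  p * w * suc p      ∎)
  where
  open ≡-Reasoning
  factor : ∀ y x p → y * (p * x) + p ≡ p * (1 + x * y)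
  factor = solve-∀

-- Polynomials as coefficient lists over ℕ

infixl 6 _+ᶜ_
infixl 7 _*ᶜ_ _·ᶜ_

_+ᶜ_ : List ℕ → List ℕ → List ℕ
[] +ᶜ s = s
(c ∷ r) +ᶜ [] = c ∷ r
(c ∷ r) +ᶜ (d ∷ s) = c + d ∷ r +ᶜ s

_·ᶜ_ : ℕ → List ℕ → List ℕ
c ·ᶜ r = map (c *_) r

-- The singleton case avoids a trailing zero, which length-*ᶜ relies on.
_*ᶜ_ : List ℕ → List ℕ → List ℕ
[] *ᶜ s = []
(c ∷ []) *ᶜ s = c ·ᶜ s
(c ∷ d ∷ r) *ᶜ s = c ·ᶜ s +ᶜ (0 ∷ (d ∷ r) *ᶜ s)

evalᶜ : List ℕ → ℕ → ℕ
evalᶜ [] b = 0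
evalᶜ (c ∷ r) b = c + b * evalᶜ r b

evalᶜ-+ᶜ : ∀ r s b → evalᶜ (r +ᶜ s) b ≡ evalᶜ r b + evalᶜ s b
evalᶜ-+ᶜ [] s b = refl
evalᶜ-+ᶜ (c ∷ r) [] b = sym (ℕ.+-identityʳ _)
evalᶜ-+ᶜ (c ∷ r) (d ∷ s) b rewrite evalᶜ-+ᶜ r s b = interchange c d b (evalᶜ r b) (evalᶜ s b)
  where
  interchange : ∀ c d b x y → c + d + b * (x + y) ≡ c + b * x + (d + b * y)
  interchange = solve-∀

evalᶜ-·ᶜ : ∀ c r b → evalᶜ (c ·ᶜ r) b ≡ c * evalᶜ r b
evalᶜ-·ᶜ c [] b = sym (ℕ.*-zeroʳ c)
evalᶜ-·ᶜ c (d ∷ r) b rewrite evalᶜ-·ᶜ c r b = factor c d b (evalᶜ r b)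
  where
  factor : ∀ c d b x → c * d + b * (c * x) ≡ c * (d + b * x)
  factor = solve-∀

evalᶜ-*ᶜ : ∀ r s b → evalᶜ (r *ᶜ s) b ≡ evalᶜ r b * evalᶜ s b
evalᶜ-*ᶜ [] s b = refl
evalᶜ-*ᶜ (c ∷ []) s b rewrite evalᶜ-·ᶜ c s b | ℕ.*-zeroʳ b | ℕ.+-identityʳ c = refl
evalᶜ-*ᶜ (c ∷ d ∷ r) s b = begin
  evalᶜ (c ·ᶜ s +ᶜ (0 ∷ (d ∷ r) *ᶜ s)) b                 ≡⟨ evalᶜ-+ᶜ (c ·ᶜ s) _ b ⟩
  evalᶜ (c ·ᶜ s) b + (0 + b * evalᶜ ((d ∷ r) *ᶜ s) b)  ≡⟨ cong₂ (λ x y → x + (0 + b * y))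
                                                           (evalᶜ-·ᶜ c s b) (evalᶜ-*ᶜ (d ∷ r) s b) ⟩
  c * S + (0 + b * (evalᶜ (d ∷ r) b * S))               ≡⟨ factor c b (evalᶜ (d ∷ r) b) S ⟩
  (c + b * evalᶜ (d ∷ r) b) * S                         ∎
  where
  open ≡-Reasoning
  S : ℕ
  S = evalᶜ s b
  factor : ∀ c b x y → c * y + (0 + b * (x * y)) ≡ (c + b * x) * y
  factor = solve-∀

length-+ᶜ : ∀ r s → length (r +ᶜ s) ≡ length r ⊔ length s
length-+ᶜ [] s = refl
length-+ᶜ (c ∷ r) [] = refl
length-+ᶜ (c ∷ r) (d ∷ s) = cong suc (length-+ᶜ r s)

length-*ᶜ : ∀ r s → length (r *ᶜ s) ≤ length r + length s ∸ 1
length-*ᶜ [] s = z≤n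
length-*ᶜ (c ∷ []) s = ℕ.≤-reflexive (length-map (c *_) s)
length-*ᶜ (c ∷ d ∷ r) s = begin
  length (c ·ᶜ s +ᶜ (0 ∷ (d ∷ r) *ᶜ s))             ≡⟨ length-+ᶜ (c ·ᶜ s) _ ⟩
  length (c ·ᶜ s) ⊔ suc (length ((d ∷ r) *ᶜ s))    ≡⟨ cong (_⊔ _) (length-map (c *_) s) ⟩
  length s ⊔ suc (length ((d ∷ r) *ᶜ s))           ≤⟨ ℕ.⊔-lub (ℕ.m≤n+m (length s) (suc (length r)))
                                                                (s≤s (length-*ᶜ (d ∷ r) s)) ⟩
  suc (length r) + length s                        ∎
  where open ℕ.≤-Reasoning

-- The quotient of r by X - a, by synthetic division.
quotientᶜ : ℕ → List ℕ → List ℕ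
quotientᶜ a [] = []
quotientᶜ a (c ∷ []) = []
quotientᶜ a (c ∷ d ∷ r) = evalᶜ (d ∷ r) a ∷ quotientᶜ a (d ∷ r)

length-quotientᶜ : ∀ a r → length (quotientᶜ a r) ≡ length r ∸ 1
length-quotientᶜ a [] = refl
length-quotientᶜ a (c ∷ []) = refl
length-quotientᶜ a (c ∷ d ∷ r) = cong suc (length-quotientᶜ a (d ∷ r))

-- r(X) = (X - a)·Q(X) + r(a), with both sides moved so that no subtraction occurs.
evalᶜ-quotientᶜ : ∀ a r b →
  evalᶜ r b + a * evalᶜ (quotientᶜ a r) b ≡ b * evalᶜ (quotientᶜ a r) b + evalᶜ r a
evalᶜ-quotientᶜ a [] b = zeros a b
  where
  zeros : ∀ a b → 0 + a * 0 ≡ b * 0 + 0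
  zeros = solve-∀
evalᶜ-quotientᶜ a (c ∷ []) b = zeros c a b
  where
  zeros : ∀ c a b → c + b * 0 + a * 0 ≡ b * 0 + (c + a * 0)
  zeros = solve-∀
evalᶜ-quotientᶜ a (c ∷ d ∷ r) b = begin
  c + b * S b + a * (S a + b * Q)    ≡⟨ regroup c a b (S b) (S a) Q ⟩
  c + a * S a + b * (S b + a * Q)    ≡⟨ cong (λ t → c + a * S a + b * t) (evalᶜ-quotientᶜ a (d ∷ r) b) ⟩
  c + a * S a + b * (b * Q + S a)    ≡⟨ regroup′ c a b (S a) Q ⟩
  b * (S a + b * Q) + (c + a * S a)  ∎
  where
  open ≡-Reasoning
  S : ℕ → ℕ
  S = evalᶜ (d ∷ r)
  Q : ℕ
  Q = evalᶜ (quotientᶜ a (d ∷ r)) b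
  regroup : ∀ c a b x y z → c + b * x + a * (y + b * z) ≡ c + a * y + b * (x + a * z)
  regroup = solve-∀
  regroup′ : ∀ c a b y z → c + a * y + b * (b * z + y) ≡ b * (y + b * z) + (c + a * y)
  regroup′ = solve-∀

quotientᶜ-divisible⇒divisible : ∀ {q} a r → All (q ∣_) (quotientᶜ a r) → q ∣ evalᶜ r a → All (q ∣_) r
quotientᶜ-divisible⇒divisible a [] _ _ = []
quotientᶜ-divisible⇒divisible {q} a (c ∷ []) _ q∣r[a] =
  subst (q ∣_) (trans (cong (c +_) (ℕ.*-zeroʳ a)) (ℕ.+-identityʳ c)) q∣r[a] ∷ []
quotientᶜ-divisible⇒divisible {q} a (c ∷ d ∷ r) (q∣s[a] ∷ q∣Q) q∣r[a] =
  ∣m+n∣m⇒∣n (subst (q ∣_) (ℕ.+-comm c _) q∣r[a]) (∣n⇒∣m*n a q∣s[a])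
  ∷ quotientᶜ-divisible⇒divisible a (d ∷ r) q∣Q q∣s[a]

module _ {q : ℕ} (isPrime : Prime q) where

  -- (a - b)·Q(b) = r(a) - r(b) ≡ 0 (mod q), and 0 < a - b < q is coprime to q.
  quotientᶜ-root : ∀ {a b} r → b < a → a < q →
                   q ∣ evalᶜ r a → q ∣ evalᶜ r b → q ∣ evalᶜ (quotientᶜ a r) b
  quotientᶜ-root {a} {b} r b<a a<q q∣r[a] q∣r[b] =
    coprime-divisor coprime (∣m+n∣m⇒∣n (subst (q ∣_) (sym shifted) q∣r[a]) q∣r[b])
    where
    Q : ℕ
    Q = evalᶜ (quotientᶜ a r) b
    coprime : Coprime q (a ∸ b)
    coprime = prime⇒coprime isPrime {{>-nonZero (ℕ.m<n⇒0<n∸m b<a)}} (ℕ.≤-<-trans (ℕ.m∸n≤m a b) a<q)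
    regroup : ∀ x y z w → y * w + (x + z * w) ≡ x + (y + z) * w
    regroup = solve-∀
    shifted : evalᶜ r b + (a ∸ b) * Q ≡ evalᶜ r a
    shifted = ℕ.+-cancelˡ-≡ (b * Q) _ _ (begin
      b * Q + (evalᶜ r b + (a ∸ b) * Q)  ≡⟨ regroup (evalᶜ r b) b (a ∸ b) Q ⟩
      evalᶜ r b + (b + (a ∸ b)) * Q      ≡⟨ cong (λ x → evalᶜ r b + x * Q) (ℕ.m+[n∸m]≡n (ℕ.<⇒≤ b<a)) ⟩
      evalᶜ r b + a * Q                  ≡⟨ evalᶜ-quotientᶜ a r b ⟩
      b * Q + evalᶜ r a                  ∎)
      where open ≡-Reasoning

  roots⇒divisible : ∀ m → m ≤ q → ∀ r → length r ≤ m →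
                    (∀ b → b < m → q ∣ evalᶜ r b) → All (q ∣_) r
  roots⇒divisible zero _ [] _ _ = []
  roots⇒divisible (suc m) m<q r length≤ roots =
    quotientᶜ-divisible⇒divisible m r
      (roots⇒divisible m (ℕ.<⇒≤ m<q) (quotientᶜ m r) length-quotient roots-quotient)
      (roots m (ℕ.n<1+n m))
    where
    length-quotient : length (quotientᶜ m r) ≤ m
    length-quotient = subst (_≤ m) (sym (length-quotientᶜ m r)) (ℕ.∸-monoˡ-≤ 1 length≤)
    roots-quotient : ∀ b → b < m → q ∣ evalᶜ (quotientᶜ m r) b
    roots-quotient b b<m = quotientᶜ-root r b<m m<q (roots m (ℕ.n<1+n m)) (roots b (ℕ.m<n⇒m<1+n b<m))

-- Polynomial expressions in one variable

module Univariate (p : ℕ) where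

  q : ℕ
  q = suc p

  open PolynomialRing q ⊤

  X : Expr ⊤
  X = var tt

  coeffs : Expr ⊤ → List ℕ
  coeffs (var _) = 0 ∷ 1 ∷ []
  coeffs (cst c) = c ∷ []
  coeffs (a ⊕ b) = coeffs a +ᶜ coeffs b
  coeffs (a ⊗ b) = coeffs a *ᶜ coeffs b
  coeffs (⊖ a) = p ·ᶜ coeffs a

  -- ⊖ is read as multiplication by p ≡ -1 (mod q), which keeps evaluation in ℕ.
  evalℕ : Expr ⊤ → ℕ → ℕ
  evalℕ (var _) x = x
  evalℕ (cst c) x = c
  evalℕ (a ⊕ b) x = evalℕ a x + evalℕ b x
  evalℕ (a ⊗ b) x = evalℕ a x * evalℕ b x
  evalℕ (⊖ a) x = p * evalℕ a x

  fromCoeffs : List ℕ → Expr ⊤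
  fromCoeffs [] = cst 0
  fromCoeffs (c ∷ r) = cst c ⊕ X ⊗ fromCoeffs r

  evalᶜ-coeffs : ∀ e b → evalᶜ (coeffs e) b ≡ evalℕ e b
  evalᶜ-coeffs (var _) b = identity b
    where
    identity : ∀ b → 0 + b * (1 + b * 0) ≡ b
    identity = solve-∀
  evalᶜ-coeffs (cst c) b = trans (cong (c +_) (ℕ.*-zeroʳ b)) (ℕ.+-identityʳ c)
  evalᶜ-coeffs (e ⊕ f) b =
    trans (evalᶜ-+ᶜ (coeffs e) (coeffs f) b) (cong₂ _+_ (evalᶜ-coeffs e b) (evalᶜ-coeffs f b))
  evalᶜ-coeffs (e ⊗ f) b =
    trans (evalᶜ-*ᶜ (coeffs e) (coeffs f) b) (cong₂ _*_ (evalᶜ-coeffs e b) (evalᶜ-coeffs f b))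
  evalᶜ-coeffs (⊖ e) b = trans (evalᶜ-·ᶜ p (coeffs e) b) (cong (p *_) (evalᶜ-coeffs e b))

  fromCoeffs-singleton : ∀ c → fromCoeffs (c ∷ []) ≈ cst c
  fromCoeffs-singleton c = ≈trans (⊕-cong ≈refl (zeroʳ X)) (+-identityʳ (cst c))

  fromCoeffs-+ᶜ : ∀ r s → fromCoeffs (r +ᶜ s) ≈ fromCoeffs r ⊕ fromCoeffs s
  fromCoeffs-+ᶜ [] s = ≈sym (⊕-idˡ _)
  fromCoeffs-+ᶜ (c ∷ r) [] = ≈sym (+-identityʳ _)
  fromCoeffs-+ᶜ (c ∷ r) (d ∷ s) = begin
    cst (c + d) ⊕ X ⊗ fromCoeffs (r +ᶜ s)
      ≈⟨ ⊕-cong (≈sym (cst-⊕ c d)) (⊗-cong ≈refl (fromCoeffs-+ᶜ r s)) ⟩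
    (cst c ⊕ cst d) ⊕ X ⊗ (fromCoeffs r ⊕ fromCoeffs s)
      ≈⟨ solve 5 (λ c d x r s → ((c :+ d) :+ x :* (r :+ s)) ⊜ ((c :+ x :* r) :+ (d :+ x :* s)))
               ≈refl (cst c) (cst d) X (fromCoeffs r) (fromCoeffs s) ⟩
    (cst c ⊕ X ⊗ fromCoeffs r) ⊕ (cst d ⊕ X ⊗ fromCoeffs s)  ∎

  fromCoeffs-·ᶜ : ∀ c r → fromCoeffs (c ·ᶜ r) ≈ cst c ⊗ fromCoeffs r
  fromCoeffs-·ᶜ c [] = ≈sym (zeroʳ _)
  fromCoeffs-·ᶜ c (d ∷ r) = begin
    cst (c * d) ⊕ X ⊗ fromCoeffs (c ·ᶜ r)
      ≈⟨ ⊕-cong (≈sym (cst-⊗ c d)) (⊗-cong ≈refl (fromCoeffs-·ᶜ c r)) ⟩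
    cst c ⊗ cst d ⊕ X ⊗ (cst c ⊗ fromCoeffs r)
      ≈⟨ solve 4 (λ c d x r → (c :* d :+ x :* (c :* r)) ⊜ (c :* (d :+ x :* r)))
               ≈refl (cst c) (cst d) X (fromCoeffs r) ⟩
    cst c ⊗ (cst d ⊕ X ⊗ fromCoeffs r)  ∎

  fromCoeffs-*ᶜ : ∀ r s → fromCoeffs (r *ᶜ s) ≈ fromCoeffs r ⊗ fromCoeffs s
  fromCoeffs-*ᶜ [] s = ≈sym (zeroˡ _)
  fromCoeffs-*ᶜ (c ∷ []) s =
    ≈trans (fromCoeffs-·ᶜ c s) (⊗-cong (≈sym (fromCoeffs-singleton c)) ≈refl)
  fromCoeffs-*ᶜ (c ∷ d ∷ r) s = begin
    fromCoeffs (c ·ᶜ s +ᶜ (0 ∷ (d ∷ r) *ᶜ s))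
      ≈⟨ fromCoeffs-+ᶜ (c ·ᶜ s) _ ⟩
    fromCoeffs (c ·ᶜ s) ⊕ (cst 0 ⊕ X ⊗ fromCoeffs ((d ∷ r) *ᶜ s))
      ≈⟨ ⊕-cong (fromCoeffs-·ᶜ c s) (≈trans (⊕-idˡ _) (⊗-cong ≈refl (fromCoeffs-*ᶜ (d ∷ r) s))) ⟩
    cst c ⊗ fromCoeffs s ⊕ X ⊗ (fromCoeffs (d ∷ r) ⊗ fromCoeffs s)
      ≈⟨ solve 4 (λ c s x r → (c :* s :+ x :* (r :* s)) ⊜ ((c :+ x :* r) :* s))
               ≈refl (cst c) (fromCoeffs s) X (fromCoeffs (d ∷ r)) ⟩
    (cst c ⊕ X ⊗ fromCoeffs (d ∷ r)) ⊗ fromCoeffs s  ∎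

  ≈fromCoeffs-coeffs : ∀ e → e ≈ fromCoeffs (coeffs e)
  ≈fromCoeffs-coeffs (var tt) = begin
    X                                  ≈⟨ *-identityʳ X ⟨
    X ⊗ cst 1                          ≈⟨ ⊗-cong ≈refl (fromCoeffs-singleton 1) ⟨
    X ⊗ fromCoeffs (1 ∷ [])            ≈⟨ ⊕-idˡ _ ⟨
    cst 0 ⊕ X ⊗ fromCoeffs (1 ∷ [])    ∎
  ≈fromCoeffs-coeffs (cst c) = ≈sym (fromCoeffs-singleton c)
  ≈fromCoeffs-coeffs (a ⊕ b) =
    ≈trans (⊕-cong (≈fromCoeffs-coeffs a) (≈fromCoeffs-coeffs b)) (≈sym (fromCoeffs-+ᶜ (coeffs a) (coeffs b)))
  ≈fromCoeffs-coeffs (a ⊗ b) =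
    ≈trans (⊗-cong (≈fromCoeffs-coeffs a) (≈fromCoeffs-coeffs b)) (≈sym (fromCoeffs-*ᶜ (coeffs a) (coeffs b)))
  ≈fromCoeffs-coeffs (⊖ a) = begin
    ⊖ a                                ≈⟨ ⊖≈p⊗ a ⟩
    cst p ⊗ a                          ≈⟨ ⊗-cong ≈refl (≈fromCoeffs-coeffs a) ⟩
    cst p ⊗ fromCoeffs (coeffs a)      ≈⟨ fromCoeffs-·ᶜ p (coeffs a) ⟨
    fromCoeffs (p ·ᶜ coeffs a)         ∎

  fromCoeffs-divisible : ∀ r → All (q ∣_) r → fromCoeffs r ≈ cst 0
  fromCoeffs-divisible [] [] = ≈refl
  fromCoeffs-divisible (c ∷ r) (q∣c ∷ q∣r) = begin
    cst c ⊕ X ⊗ fromCoeffs r  ≈⟨ ⊕-cong (cst-∣⇒≈0 q∣c) (⊗-cong ≈refl (fromCoeffs-divisible r q∣r)) ⟩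
    cst 0 ⊕ X ⊗ cst 0         ≈⟨ ⊕-idˡ _ ⟩
    X ⊗ cst 0                 ≈⟨ zeroʳ X ⟩
    cst 0                     ∎

  roots⇒≈0 : Prime q → ∀ e → length (coeffs e) ≤ q →
             (∀ (i : Fin q) → q ∣ evalℕ e (toℕ i)) → e ≈ cst 0
  roots⇒≈0 isPrime e degree roots = begin
    e                      ≈⟨ ≈fromCoeffs-coeffs e ⟩
    fromCoeffs (coeffs e)  ≈⟨ fromCoeffs-divisible (coeffs e)
                                (roots⇒divisible isPrime q ℕ.≤-refl (coeffs e) degree rootsᶜ) ⟩
    cst 0                  ∎
    where
    rootsᶜ : ∀ b → b < q → q ∣ evalᶜ (coeffs e) b
    rootsᶜ b b<q = subst (q ∣_) (sym (trans (evalᶜ-coeffs e b) (cong (evalℕ e) (sym (toℕ-fromℕ< b<q)))))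
                     (roots (fromℕ< b<q))

  length-coeffs-sumFin : ∀ {m} n (f : Fin n → Expr ⊤) →
    (∀ i → length (coeffs (f i)) ≤ suc m) → length (coeffs (sumFin n f)) ≤ suc m
  length-coeffs-sumFin zero f bound = s≤s z≤n
  length-coeffs-sumFin (suc n) f bound =
    subst (_≤ _) (sym (length-+ᶜ (coeffs (f fz)) _))
      (ℕ.⊔-lub (bound fz) (length-coeffs-sumFin n (λ i → f (fs i)) (λ i → bound (fs i))))

  length-coeffs-prodFin : ∀ n (f : Fin n → Expr ⊤) →
    (∀ i → length (coeffs (f i)) ≤ 2) → length (coeffs (prodFin n f)) ≤ suc n
  length-coeffs-prodFin zero f linear = ℕ.≤-refl
  length-coeffs-prodFin (suc n) f linear = ℕ.≤-trans (length-*ᶜ (coeffs (f fz)) _)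
    (ℕ.∸-monoˡ-≤ 1 (ℕ.+-mono-≤ (linear fz) (length-coeffs-prodFin n (λ i → f (fs i)) (λ i → linear (fs i)))))

  length-coeffs-prodFin-constant : ∀ n (f : Fin n → Expr ⊤) (j : Fin n) →
    length (coeffs (f j)) ≤ 1 → (∀ i → length (coeffs (f i)) ≤ 2) → length (coeffs (prodFin n f)) ≤ n
  length-coeffs-prodFin-constant (suc n) f fz constant linear = ℕ.≤-trans (length-*ᶜ (coeffs (f fz)) _)
    (ℕ.∸-monoˡ-≤ 1 (ℕ.+-mono-≤ constant (length-coeffs-prodFin n (λ i → f (fs i)) (λ i → linear (fs i)))))
  length-coeffs-prodFin-constant (suc n) f (fs j) constant linear = ℕ.≤-trans (length-*ᶜ (coeffs (f fz)) _)
    (ℕ.∸-monoˡ-≤ 1 (ℕ.+-mono-≤ (linear fz)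
      (length-coeffs-prodFin-constant n (λ i → f (fs i)) j constant (λ i → linear (fs i)))))

  ∣evalℕ-sumFin : ∀ n (f : Fin n → Expr ⊤) b →
    (∀ i → q ∣ evalℕ (f i) b) → q ∣ evalℕ (sumFin n f) b
  ∣evalℕ-sumFin zero f b q∣f = divides 0 refl
  ∣evalℕ-sumFin (suc n) f b q∣f =
    ∣m∣n⇒∣m+n (q∣f fz) (∣evalℕ-sumFin n (λ i → f (fs i)) b (λ i → q∣f (fs i)))

  ∣evalℕ-sumFin-single : ∀ n (f : Fin n → Expr ⊤) b (j : Fin n) z →
    (∀ i → i ≢ j → q ∣ evalℕ (f i) b) → q ∣ evalℕ (f j) b + z → q ∣ evalℕ (sumFin n f) b + z
  ∣evalℕ-sumFin-single (suc n) f b fz z q∣f[i] q∣f[j]+z =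
    subst (q ∣_) (regroup (evalℕ (f fz) b) (evalℕ (sumFin n (λ i → f (fs i))) b) z)
      (∣m∣n⇒∣m+n q∣f[j]+z (∣evalℕ-sumFin n (λ i → f (fs i)) b (λ i → q∣f[i] (fs i) (λ ()))))
    where
    regroup : ∀ x y z → x + z + y ≡ x + y + z
    regroup = solve-∀
  ∣evalℕ-sumFin-single (suc n) f b (fs j) z q∣f[i] q∣f[j]+z =
    subst (q ∣_) (sym (ℕ.+-assoc (evalℕ (f fz) b) _ z))
      (∣m∣n⇒∣m+n (q∣f[i] fz (λ ()))
        (∣evalℕ-sumFin-single n (λ i → f (fs i)) b j z
          (λ i i≢j → q∣f[i] (fs i) (i≢j ∘ suc-injective)) q∣f[j]+z))

  evalℕ-prodFin : ∀ n (f : Fin n → Expr ⊤) b → evalℕ (prodFin n f) b ≡ prodℕ n (λ i → evalℕ (f i) b)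
  evalℕ-prodFin zero f b = refl
  evalℕ-prodFin (suc n) f b = cong (evalℕ (f fz) b *_) (evalℕ-prodFin n (λ i → f (fs i)) b)

  evalℕ-UBIT : ∀ j b → evalℕ (UBIT q j X) b ≡
               ubitDen q j ^ (q ∸ 2) * prodℕ q (λ i → if eqF i j then 1 else b + p * toℕ i)
  evalℕ-UBIT j b = cong (ubitDen q j ^ (q ∸ 2) *_)
    (trans (evalℕ-prodFin q (ubitFactor q j X) b) (prodℕ-cong q evalℕ-factor))
    where
    evalℕ-factor : ∀ i → evalℕ (ubitFactor q j X i) b ≡ (if eqF i j then 1 else b + p * toℕ i)
    evalℕ-factor i = if-float (λ e → evalℕ e b) (eqF i j)

  length-coeffs-UBIT : ∀ j → length (coeffs (UBIT q j X)) ≤ q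
  length-coeffs-UBIT j = subst (_≤ q) (sym (length-map _ (coeffs (prodFin q factor))))
    (length-coeffs-prodFin-constant q factor j constant linear)
    where
    factor : Fin q → Expr ⊤
    factor = ubitFactor q j X
    linear : ∀ i → length (coeffs (factor i)) ≤ 2
    linear i with eqF i j
    ... | true = s≤s z≤n
    ... | false = ℕ.≤-refl
    constant : length (coeffs (factor j)) ≤ 1
    constant with eqF j j | eqF-reflects-≡ j j
    ... | true | _ = ℕ.≤-refl
    ... | false | ofⁿ j≢j = contradiction refl j≢j

  UBIT-vanishes : ∀ {i j} → i ≢ j → q ∣ evalℕ (UBIT q j X) (toℕ i)
  UBIT-vanishes {i} {j} i≢j =
    subst (q ∣_) (sym (evalℕ-UBIT j (toℕ i))) (∣n⇒∣m*n (ubitDen q j ^ (q ∸ 2))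
      (∣-prodℕ q (λ k → if eqF k j then 1 else toℕ i + p * toℕ k) i factor-vanishes))
    where
    factor-vanishes : q ∣ (if eqF i j then 1 else toℕ i + p * toℕ i)
    factor-vanishes with eqF i j | eqF-reflects-≡ i j
    ... | true | ofʸ i≡j = contradiction i≡j i≢j
    ... | false | _ = m∣m*n (toℕ i)

  -- Every factor, in the denominator as in the numerator, is ≡ j - i ≢ 0 (mod q).
  UBIT-nonvanishing : Prime q → ∀ j → ¬ q ∣ evalℕ (UBIT q j X) (toℕ j)
  UBIT-nonvanishing isPrime j = subst (λ v → ¬ q ∣ v) (sym (evalℕ-UBIT j (toℕ j)))
    (∤-* isPrime (∤-^ isPrime (q ∸ 2) (∤-prodℕ isPrime q _ denominator))
                 (∤-prodℕ isPrime q _ numerator))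
    where
    denominator : ∀ i → ¬ q ∣ (if eqF i j then 1 else toℕ j + q ∸ toℕ i)
    denominator i with eqF i j | eqF-reflects-≡ i j
    ... | true | _ = ∤1 isPrime
    ... | false | ofⁿ i≢j = i≢j ∘ ∣-offset⇒≡ 1
      (trans (ℕ.m∸n+n≡m (ℕ.≤-trans (ℕ.<⇒≤ (toℕ<n i)) (ℕ.m≤n+m q (toℕ j))))
             (cong (toℕ j +_) (sym (ℕ.*-identityˡ q))))
    numerator : ∀ i → ¬ q ∣ (if eqF i j then 1 else toℕ j + p * toℕ i)
    numerator i with eqF i j | eqF-reflects-≡ i j
    ... | true | _ = ∤1 isPrime
    ... | false | ofⁿ i≢j = i≢j ∘ ∣-offset⇒≡ (toℕ i) (regroup (toℕ j) p (toℕ i))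
      where
      regroup : ∀ x p y → x + p * y + y ≡ x + y * suc p
      regroup = solve-∀

  -- S - X vanishes at every i : F_q, since L j vanishes at i ≠ j and c i inverts L i (i); as its
  -- degree is < q, it is 0.
  lagrange-X : Prime q → (L : Fin q → Expr ⊤) →
    (∀ j → length (coeffs (L j)) ≤ q) →
    (∀ {i j} → i ≢ j → q ∣ evalℕ (L j) (toℕ i)) →
    (∀ j → ¬ q ∣ evalℕ (L j) (toℕ j)) →
    Σ (Fin q → ℕ) λ c → sumFin q (λ j → cst (toℕ j * c j) ⊗ L j) ≈ X
  lagrange-X isPrime L degree vanishes nonvanishing =
    c , x∙y⁻¹≈ε⇒x≈y S X (roots⇒≈0 isPrime (S ⊕ ⊖ X) degree-S-X roots)
    where
    c : Fin q → ℕ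
    c j = proj₁ (inverse-mod isPrime (nonvanishing j))
    term : Fin q → Expr ⊤
    term j = cst (toℕ j * c j) ⊗ L j
    S : Expr ⊤
    S = sumFin q term
    degree-S-X : length (coeffs (S ⊕ ⊖ X)) ≤ q
    degree-S-X = subst (_≤ q) (sym (length-+ᶜ (coeffs S) _))
      (ℕ.⊔-lub (length-coeffs-sumFin q term
                  (λ j → subst (_≤ q) (sym (length-map (toℕ j * c j *_) (coeffs (L j)))) (degree j)))
               (nonTrivial⇒n>1 q {{prime⇒nonTrivial isPrime}}))
    roots : ∀ i → q ∣ evalℕ (S ⊕ ⊖ X) (toℕ i)
    roots i = ∣evalℕ-sumFin-single q term (toℕ i) i (p * toℕ i)
      (λ j j≢i → ∣n⇒∣m*n (toℕ j * c j) (vanishes (≢-sym j≢i)))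
      (subst (q ∣_) (regroup (toℕ i) (c i) (evalℕ (L i) (toℕ i)) p)
        (∣n⇒∣m*n (toℕ i) (proj₂ (inverse-mod isPrime (nonvanishing i)))))
      where
      regroup : ∀ t c y p → t * (y * c + p) ≡ t * c * y + p * t
      regroup = solve-∀

module Interpolation {p : ℕ} (isPrime : Prime (suc p)) where
  open Univariate p using (X; lagrange-X; length-coeffs-UBIT; UBIT-vanishes; UBIT-nonvanishing)

  private
    lagrange : Σ (Fin (suc p) → ℕ) λ c →
               PolyEq (suc p) (sumFin (suc p) (λ j → cst (toℕ j * c j) ⊗ UBIT (suc p) j X)) X
    lagrange = lagrange-X isPrime (λ j → UBIT (suc p) j X)
                 length-coeffs-UBIT UBIT-vanishes (UBIT-nonvanishing isPrime)

  coefficient : Fin p → ℕ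
  coefficient j = suc (toℕ j) * proj₁ lagrange (fs j)

  -- The summand j = 0 has coefficient 0.
  interpolation : ∀ {V} (h : Expr V) →
    PolyEq (suc p) (sumFin p (λ j → cst (coefficient j) ⊗ UBIT (suc p) (fs j) h)) h
  interpolation {V} h = begin
    sumFin p (λ j → cst (coefficient j) ⊗ UBIT (suc p) (fs j) h)
      ≈⟨ ⊕-idˡ _ ⟨
    cst 0 ⊕ sumFin p (λ j → cst (coefficient j) ⊗ UBIT (suc p) (fs j) h)
      ≈⟨ ⊕-cong (zeroˡ (UBIT (suc p) fz h)) ≈refl ⟨
    sumFin (suc p) (λ j → cst (toℕ j * c j) ⊗ UBIT (suc p) j h)
      ≈⟨ sumFin-cong (suc p) (λ j → ⊗-cong (≈refl {a = cst (toℕ j * c j)})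
                                         (reflexive (substE-UBIT (λ _ → h) (suc p) j X))) ⟨
    sumFin (suc p) (λ j → substE (λ _ → h) (summand j))
      ≡⟨ substE-sumFin (λ _ → h) (suc p) summand ⟨
    substE (λ _ → h) (sumFin (suc p) summand)
      ≈⟨ substE-cong (λ _ → h) (proj₂ lagrange) ⟩
    h  ∎
    where
    open PolynomialRing (suc p) V
    c : Fin (suc p) → ℕ
    c = proj₁ lagrange
    summand : Fin (suc p) → Expr ⊤
    summand j = cst (toℕ j * c j) ⊗ UBIT (suc p) j X

module _ {p : ℕ} {W : Set} where

  -- Each summand adds four nodes, newest first: the running sum, the product c ⊗ w, c and w.
  linearCombination : ∀ m → (Fin m → Fin (suc p) × W) → Circuit (suc p) W (suc (m * 4))
  linearCombination zero f = scalar fz ◁ []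
  linearCombination (suc m) f =
    gate plus fz (fs (fs (fs fz))) [] ◁ (gate times fz (fs fz) [] ◁
      (scalar (proj₁ (f fz)) ◁ (input (proj₂ (f fz)) ◁ linearCombination m (f ∘ fs))))

  outPoly-linearCombination : ∀ m f → outPoly (linearCombination m f) ≡
    sumFin m (λ i → cst (toℕ (proj₁ (f i))) ⊗ var (proj₂ (f i)))
  outPoly-linearCombination zero f = refl
  outPoly-linearCombination (suc m) f =
    cong (cst (toℕ (proj₁ (f fz))) ⊗ var (proj₂ (f fz)) ⊕_) (outPoly-linearCombination m (f ∘ fs))

  size-linearCombination : ∀ m f → size (linearCombination m f) ≡ suc (m * 8)
  size-linearCombination zero f = refl
  size-linearCombination (suc m) f = cong (8 +_) (size-linearCombination m (f ∘ fs))

  depth-linearCombination : ∀ m f → depth (linearCombination m f) ≤ suc m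
  depth-linearCombination zero f = z≤n
  depth-linearCombination (suc m) f =
    ℕ.⊔-lub (s≤s (ℕ.⊔-lub (ℕ.⊔-lub (s≤s z≤n) (ℕ.≤-trans (nodeDepth≤depth C) depth-C)) z≤n))
            (ℕ.⊔-lub (s≤s z≤n) (ℕ.≤-trans depth-C (ℕ.n≤1+n (suc m))))
    where
    C : Circuit (suc p) W (suc (m * 4))
    C = linearCombination m (f ∘ fs)
    depth-C : depth C ≤ suc m
    depth-C = depth-linearCombination m (f ∘ fs)
    nodeDepth≤depth : ∀ {k} (D : Circuit (suc p) W (suc k)) → nodeDepth D fz ≤ depth D
    nodeDepth≤depth (g ◁ D) = ℕ.m≤m⊔n _ _

linearCombination-IPSProof : ∀ {p n} (A : List (Expr (Fin n))) {m} (c : Fin m → Fin (suc p))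
  (axiom : Fin m → Expr (Fin n)) (axiom∈A : ∀ i → axiom i ∈ A) {P : Expr (Fin n)} →
  PolyEq (suc p) (sumFin m (λ i → cst (toℕ (c i)) ⊗ axiom i)) P → IPSProof (suc p) n A P
linearCombination-IPSProof {p} {n} A {m} c axiom axiom∈A combination≈P = record
  { k = m * 4
  ; D = D
  ; vanish = ≈trans (reflexive (substE-outPoly _)) (sumFin-zero m (λ i → zeroʳ _))
  ; derive = ≈trans (reflexive (substE-outPoly _))
      (≈trans (sumFin-cong m (λ i → ⊗-cong ≈refl (reflexive (sym (lookup-index (axiom∈A i)))))) combination≈P)
  }
  where
  open PolynomialRing (suc p) (Fin n)
  D : Circuit (suc p) (Fin n ⊎ Fin (length A)) (suc (m * 4))
  D = linearCombination m (λ i → c i , inj₂ (index (axiom∈A i)))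
  substE-outPoly : ∀ σ → substE σ (outPoly D) ≡
                   sumFin m (λ i → cst (toℕ (c i)) ⊗ σ (inj₂ (index (axiom∈A i))))
  substE-outPoly σ = trans (cong (substE σ) (outPoly-linearCombination m _)) (substE-sumFin σ m _)

outputAxiom∈ : ∀ {p n k} (C : Circuit (suc p) (Fin n) (suc k)) (j : Fin p) →
               UBIT (suc p) (fs j) (outPoly C) ∈ fieldAx (suc p) C ++ SCNF (suc p) C
outputAxiom∈ {p} C j =
  ∈-++⁺ʳ (fieldAx (suc p) C) (∈-++⁺ʳ (scnfNodes (suc p) C) (∈-map⁺ _ (∈-allFin (fs j))))

outPoly-IPSProof : ∀ {p} → Prime (suc p) → ∀ n {k} (C : Circuit (suc p) (Fin n) (suc k)) →
                   IPSProof (suc p) n (fieldAx (suc p) C ++ SCNF (suc p) C) (outPoly C)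
outPoly-IPSProof {p} isPrime n C =
  linearCombination-IPSProof _ (λ j → coefficient j mod suc p)
    (λ j → UBIT (suc p) (fs j) (outPoly C)) (outputAxiom∈ C)
    (≈trans (sumFin-cong p (λ j → ⊗-cong (cst-mod (coefficient j)) ≈refl)) (interpolation (outPoly C)))
  where open Interpolation isPrime

lemma6p12 : (q : ℕ) .{{_ : NonZero q}} → Prime q →
    Σ ℕ λ c → Σ ℕ λ e →
    ∀ (n : ℕ) {k : ℕ} (C : Circuit q (Fin n) (suc k)) →
    Σ (IPSProof q n (fieldAx q C ++ SCNF q C) (outPoly C)) λ π →
      (size (IPSProof.D π) ≤ c * size C ^ e)
      × (depth (IPSProof.D π) ≤ c * depth C + c)
lemma6p12 zero isPrime = contradiction isPrime ¬prime[0]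
lemma6p12 (suc p) isPrime = suc (p * 8) , 0 , λ n C →
  outPoly-IPSProof isPrime n C ,
  ℕ.≤-reflexive (trans (size-linearCombination p _) (sym (ℕ.*-identityʳ _))) ,
  ℕ.≤-trans (depth-linearCombination p _) (ℕ.≤-trans (s≤s (ℕ.m≤m*n p 8)) (ℕ.m≤n+m _ _))
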